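{- Let $\mathbb{L},\mathbb{B}$ be continuous complete lattices with join bases $J_{\mathbb{L}},J_{\mathbb{B}}$ such that $\bot\notin J_{\mathbb{L}}$, $\bot\notin J_{\mathbb{B}}$ and $J_{\mathbb{B}}$ consists only of way-below irreducible elements; let $\alpha\dashv\gamma$ be a Galois connection with $\alpha\colon\mathbb{L}\to\mathbb{B}$, and let $\lambda\colon\mathbb{L}\to\mathbb{L}$, $\beta\colon\mathbb{B}\to\mathbb{B}$ be monotone with $\alpha\circ\lambda=\beta\circ\alpha$. Assume $\beta$ is Scott-continuous and let $S$ be a finitary winning strategy for $\exists$ in the primal way-below game on $\beta$, i.e. $S$ assigns to every $b\in J_{\mathbb{B}}$ with $b\ll\mu\beta$ a finite set $S(b)\subseteq J_{\mathbb{B}}$ with $b\ll\beta(\bigsqcup S(b))$ and $\deg_\beta(b')<\deg_\beta(b)$ for all $b'\in S(b)$. For $b\in J_{\mathbb{B}}$ and finite $A\subseteq J_{\mathbb{L}}$ with $b\ll\alpha(\lambda(\bigsqcup A))$ let $P(b,A)$ denote a chosen element $a\in J_{\mathbb{L}}$ with $a\ll\lambda(\bigsqcup A)$ and $b\ll\alpha(a)$. Then for every $b\in J_{\mathbb{B}}$ with $b\ll\mu\beta$, the recursion $$\mathit{wit}(b)=P\big(b,\{\mathit{wit}(b')\mid b'\in S(b)\}\big)$$ is a well-defined inductive definition with base case $S(b)=\emptyset$, it yields a primal witness $\mathit{wit}(b)$ for $b$, and $\deg_\lambda(\mathit{wit}(b))\le\deg_\beta(b)$.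
   Context: Galois connection: monotone $\alpha,\gamma$ with $\ell\sqsubseteq\gamma\alpha(\ell)$ and $\alpha\gamma(d)\sqsubseteq d$. $\mu f$: least fixpoint. $x\ll y$: for every directed $D$ with $y\sqsubseteq\bigsqcup D$ there is $d\in D$ with $x\sqsubseteq d$. Continuous lattice: $\ell=\bigsqcup\{\ell'\mid\ell'\ll\ell\}$. Join basis $J$: $\ell=\bigsqcup\{b\in J\mid b\sqsubseteq\ell\}$. Way-below irreducible $b$: $b\ll\bigsqcup F$ with $F$ finite implies $b\ll f$ for some $f\in F$. Scott-continuous: preserves directed joins. Kleene iterates $f^i(\bot)$ over ordinals; degree $\deg_f(x)=\min\{i\mid x\ll f^i(\bot)\}$. Primal witness for $b$: $a\in\mathbb{L}$ with $a\ll\mu\lambda$ and $b\ll\alpha(a)$. Primal way-below game on $\beta$: at $b\in J_{\mathbb{B}}$, $\exists$ chooses $d$ with $b\ll\beta(d)$; at $d$, $\forall$ chooses $b'\in J_{\mathbb{B}}$ with $b'\ll d$; a player unable to move loses; infinite plays are won by $\forall$. -}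

module Defs where

open import Level using (0ℓ) renaming (suc to lsuc)
open import Data.Nat using (ℕ; zero; suc; _<_; _≤_)
open import Data.Product using (Σ; ∃; _×_; _,_)
open import Data.Empty renaming (⊥ to Empty)
open import Data.List using (List)
open import Data.List.Membership.Propositional using (_∈_)
open import Relation.Binary.PropositionalEquality using (_≡_)
open import Relation.Nullary using (¬_)

record CompleteLattice : Set₁ where
  field
    Carrier   : Set
    _⊑_       : Carrier → Carrier → Set
    ⊑-refl    : ∀ {x} → x ⊑ x
    ⊑-trans   : ∀ {x y z} → x ⊑ y → y ⊑ z → x ⊑ z
    ⊑-antisym : ∀ {x y} → x ⊑ y → y ⊑ x → x ≡ y
    ⋁         : (Carrier → Set) → Carrier
    ⋁-upper   : (P : Carrier → Set) → ∀ {x} → P x → x ⊑ ⋁ P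
    ⋁-least   : (P : Carrier → Set) → ∀ {u} → (∀ {x} → P x → x ⊑ u) → ⋁ P ⊑ u

open CompleteLattice public using (Carrier)

module _ (L : CompleteLattice) where
  open CompleteLattice L hiding (Carrier)

  [_]_⊑_ : Carrier L → Carrier L → Set
  [_]_⊑_ = _⊑_

  bot : Carrier L
  bot = ⋁ (λ _ → Empty)

  ⨆ : List (Carrier L) → Carrier L
  ⨆ A = ⋁ (λ x → x ∈ A)

  Directed : (Carrier L → Set) → Set
  Directed D = (∃ λ d → D d) × (∀ {x y} → D x → D y → ∃ λ z → D z × (x ⊑ z) × (y ⊑ z))

  [_]_≪_ : Carrier L → Carrier L → Set₁
  [_]_≪_ x y = (D : Carrier L → Set) → Directed D → y ⊑ ⋁ D → ∃ λ d → D d × (x ⊑ d)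

  -- continuous lattice: l = ⋁ {l' | l' ≪ l}  (the join unfolded, since
  -- {l' | l' ≪ l} lives one universe up): l is below every upper bound of it
  -- (and it is trivially an upper bound).
  IsContinuous : Set₁
  IsContinuous = ∀ l → (∀ l' → [_]_≪_ l' l → l' ⊑ l) × (∀ u → (∀ l' → [_]_≪_ l' l → l' ⊑ u) → l ⊑ u)

  IsJoinBasis : (Carrier L → Set) → Set
  IsJoinBasis J = ∀ l → l ≡ ⋁ (λ b → J b × (b ⊑ l))

  WayBelowIrreducible : Carrier L → Set₁
  WayBelowIrreducible b = (F : List (Carrier L)) → [_]_≪_ b (⨆ F) → ∃ λ f → f ∈ F × [_]_≪_ b f

  ScottContinuous : (Carrier L → Carrier L) → Set₁
  ScottContinuous f = (D : Carrier L → Set) → Directed D →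
    f (⋁ D) ≡ ⋁ (λ y → ∃ λ x → D x × (y ≡ f x))

  IsLfp : (Carrier L → Carrier L) → Carrier L → Set
  IsLfp f m = (f m ≡ m) × (∀ x → f x ≡ x → m ⊑ x)

  iter : (Carrier L → Carrier L) → ℕ → Carrier L
  iter f zero    = bot
  iter f (suc n) = f (iter f n)

  -- Deg f x n  :  deg_f(x) = n  (for a finite ordinal n): x ≪ f^n(⊥) and
  -- x ≪ f^m(⊥) for no smaller m (all ordinals below n are finite).
  Deg : (Carrier L → Carrier L) → Carrier L → ℕ → Set₁
  Deg f x n = [_]_≪_ x (iter f n) × (∀ m → m < n → ¬ [_]_≪_ x (iter f m))

module _ (L B : CompleteLattice) where
  private
    module L = CompleteLattice L
    module B = CompleteLattice B

  Monotone : (Carrier L → Carrier B) → Set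
  Monotone f = ∀ {x y} → x L.⊑ y → f x B.⊑ f y

  GaloisConnection : (Carrier L → Carrier B) → (Carrier B → Carrier L) → Set
  GaloisConnection α γ =
    Monotone α × Monotone' γ × (∀ l → l L.⊑ γ (α l)) × (∀ d → α (γ d) B.⊑ d)
    where
    Monotone' : (Carrier B → Carrier L) → Set
    Monotone' g = ∀ {x y} → x B.⊑ y → g x L.⊑ g y

  PrimalWitness : (Carrier L → Carrier B) → Carrier L → Carrier B → Carrier L → Set₁
  PrimalWitness α μλ b a = ([ L ] a ≪ μλ) × ([ B ] b ≪ α a)

{-# OPTIONS --safe #-}
-- Every b ∈ J_B way below μβ has a finite degree: μβ lies below the join of
-- the Kleene iterates of the Scott-continuous β, and since B is continuous the
-- elements way below some iterate form a directed set whose join is above μβ.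
-- The strategy S strictly lowers degrees, so induction on the degree shows
-- that unfolding the recursion n times gives the same value for every n at or
-- above the degree of b; that value is wit b. The same induction shows that it
-- is a basic element a ≪ λⁿ(⊥) ⊑ μλ with b ≪ α(a): if A collects the
-- witnesses of the children, ⨆ S(b) ⊑ α(⨆ A), hence
-- b ≪ β(⨆ S(b)) ⊑ β(α(⨆ A)) = α(λ(⨆ A)) and P applies.
module Submission where

open import Defs
open import Level using (0ℓ) renaming (suc to lsuc)
open import Axiom.ExcludedMiddle using (ExcludedMiddle)
open import Data.Nat using (ℕ; zero; suc; _<_; _≤_; z≤n; s≤s; _⊔_)
open import Data.Nat.Properties
  using (≤-refl; ≤-trans; ≤-pred; n≤1+n; m≤m⊔n; m≤n⊔m; <-cmp; m<1+n⇒m<n∨m≡n)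
open import Data.Nat.Induction using (<-rec)
open import Data.Product using (Σ; ∃; _×_; _,_; proj₁; proj₂)
open import Data.Sum using (_⊎_; inj₁; inj₂)
open import Data.Empty using (⊥-elim)
open import Data.List using (List; []; _∷_; map)
open import Data.List.Properties using (map-cong-local)
open import Data.List.Membership.Propositional using (_∈_)
open import Data.List.Membership.Propositional.Properties using (∈-map⁺; ∈-map⁻)
open import Data.List.Relation.Unary.All using (All; tabulate; lookup)
open import Data.List.Relation.Unary.All.Properties using (map⁺)
open import Data.List.Relation.Unary.Any using (here; there)
open import Relation.Binary.PropositionalEquality using (_≡_; refl; sym; trans; cong; subst)
open import Relation.Binary.Definitions using (tri<; tri≈; tri>)
open import Relation.Nullary using (¬_; yes; no)
open import Relation.Nullary.Decidable using (True; toWitness; fromWitness)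

module LeastNumber {ℓ} (em : ExcludedMiddle ℓ) (Q : ℕ → Set ℓ) where

  Minimal : ℕ → Set ℓ
  Minimal i = Q i × (∀ m → m < i → ¬ Q m)

  minimal-below-or-none : ∀ n → (∃ λ i → i < n × Minimal i) ⊎ (∀ m → m < n → ¬ Q m)
  minimal-below-or-none zero = inj₂ λ _ ()
  minimal-below-or-none (suc n) with minimal-below-or-none n
  ... | inj₁ (i , i<n , min) = inj₁ (i , ≤-trans i<n (n≤1+n n) , min)
  ... | inj₂ none with em {Q n}
  ...   | yes q = inj₁ (n , ≤-refl , q , none)
  ...   | no ¬q = inj₂ λ m m<1+n → none-up-to-n (m<1+n⇒m<n∨m≡n m<1+n)
    where
    none-up-to-n : ∀ {m} → m < n ⊎ m ≡ n → ¬ Q m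
    none-up-to-n (inj₁ m<n) = none _ m<n
    none-up-to-n (inj₂ refl) = ¬q

  minimal-below : ∀ {n} → Q n → ∃ λ i → i ≤ n × Minimal i
  minimal-below {n} q with minimal-below-or-none (suc n)
  ... | inj₁ (i , i<1+n , min) = i , ≤-pred i<1+n , min
  ... | inj₂ none = ⊥-elim (none n ≤-refl q)

module WayBelow (L : CompleteLattice) where
  open CompleteLattice L public hiding (Carrier)

  _≪_ : Carrier L → Carrier L → Set₁
  x ≪ y = [ L ] x ≪ y

  ⊑-reflexive : ∀ {x y} → x ≡ y → x ⊑ y
  ⊑-reflexive refl = ⊑-refl

  bot-minimum : ∀ x → bot L ⊑ x
  bot-minimum x = ⋁-least _ λ ()

  ≪⇒⊑ : ∀ {x y} → x ≪ y → x ⊑ y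
  ≪⇒⊑ {x} {y} x≪y with x≪y (_≡ y) ((y , refl) , λ { refl refl → y , refl , ⊑-refl , ⊑-refl }) (⋁-upper _ refl)
  ... | _ , refl , x⊑y = x⊑y

  ⊑-≪-trans : ∀ {x y z} → x ⊑ y → y ≪ z → x ≪ z
  ⊑-≪-trans x⊑y y≪z D D-directed z⊑⋁D with y≪z D D-directed z⊑⋁D
  ... | d , d∈D , y⊑d = d , d∈D , ⊑-trans x⊑y y⊑d

  ≪-⊑-trans : ∀ {x y z} → x ≪ y → y ⊑ z → x ≪ z
  ≪-⊑-trans x≪y y⊑z D D-directed z⊑⋁D = x≪y D D-directed (⊑-trans y⊑z z⊑⋁D)

  bot-≪ : ∀ {x} → bot L ≪ x
  bot-≪ D ((d , d∈D) , _) _ = d , d∈D , bot-minimum d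

  ≪bot⇒≡bot : ∀ {x} → x ≪ bot L → x ≡ bot L
  ≪bot⇒≡bot x≪bot = ⊑-antisym (≪⇒⊑ x≪bot) (bot-minimum _)

  ≪-pair : ∀ {x y z} → x ≪ z → y ≪ z → ⨆ L (x ∷ y ∷ []) ≪ z
  ≪-pair x≪z y≪z D D-directed z⊑⋁D
    with x≪z D D-directed z⊑⋁D | y≪z D D-directed z⊑⋁D
  ... | d₁ , d₁∈D , x⊑d₁ | d₂ , d₂∈D , y⊑d₂ with proj₂ D-directed d₁∈D d₂∈D
  ... | d , d∈D , d₁⊑d , d₂⊑d = d , d∈D , ⋁-least _ λ
    { (here refl) → ⊑-trans x⊑d₁ d₁⊑d
    ; (there (here refl)) → ⊑-trans y⊑d₂ d₂⊑d
    }

module Kleene (L : CompleteLattice) (f : Carrier L → Carrier L) (f-mono : Monotone L L f) where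
  open WayBelow L

  iter-mono : ∀ {m n} → m ≤ n → iter L f m ⊑ iter L f n
  iter-mono {n = n} z≤n = bot-minimum (iter L f n)
  iter-mono (s≤s m≤n) = f-mono (iter-mono m≤n)

  iter⊑fixpoint : ∀ {x} → f x ≡ x → ∀ n → iter L f n ⊑ x
  iter⊑fixpoint {x} fx≡x zero = bot-minimum x
  iter⊑fixpoint fx≡x (suc n) = ⊑-trans (f-mono (iter⊑fixpoint fx≡x n)) (⊑-reflexive fx≡x)

  Deg-unique : ∀ {x m n} → Deg L f x m → Deg L f x n → m ≡ n
  Deg-unique {m = m} {n} (x≪fᵐ , below-m) (x≪fⁿ , below-n) with <-cmp m n
  ... | tri< m<n _ _ = ⊥-elim (below-n m m<n x≪fᵐ)
  ... | tri≈ _ m≡n _ = m≡n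
  ... | tri> _ _ n<m = ⊥-elim (below-m n n<m x≪fⁿ)

  ≪-iter⇒Deg≤ : ExcludedMiddle (lsuc 0ℓ) → ∀ {x n} → x ≪ iter L f n → ∃ λ i → i ≤ n × Deg L f x i
  ≪-iter⇒Deg≤ em {x} = LeastNumber.minimal-below em (λ i → x ≪ iter L f i)

  Iterate : Carrier L → Set
  Iterate x = ∃ λ n → x ≡ iter L f n

  iterates-directed : Directed L Iterate
  iterates-directed = (bot L , 0 , refl) , λ
    { (m , refl) (n , refl) →
      iter L f (m ⊔ n) , (m ⊔ n , refl) , iter-mono (m≤m⊔n m n) , iter-mono (m≤n⊔m m n) }

  module _ (f-continuous : ScottContinuous L f) {μ : Carrier L} (μ-lfp : IsLfp L f μ) where

    ⋁-iterates-fixpoint : f (⋁ Iterate) ≡ ⋁ Iterate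
    ⋁-iterates-fixpoint = trans (f-continuous Iterate iterates-directed) (⊑-antisym
      (⋁-least _ λ { (_ , (n , refl) , refl) → ⋁-upper _ (suc n , refl) })
      (⋁-least _ λ
        { (zero , refl) → bot-minimum _
        ; (suc n , refl) → ⋁-upper _ (iter L f n , (n , refl) , refl) }))

    lfp⊑⋁iterates : μ ⊑ ⋁ Iterate
    lfp⊑⋁iterates = proj₂ μ-lfp _ ⋁-iterates-fixpoint

    module _ (em : ExcludedMiddle (lsuc 0ℓ)) (L-continuous : IsContinuous L) where

      -- A join may only range over a predicate in Set, whereas ≪ lives in
      -- Set₁: excluded middle resizes "x is way below some iterate" via True.
      BelowIterate : Carrier L → Set
      BelowIterate x = True (em {∃ λ n → x ≪ iter L f n})

      below-iterate : ∀ {x} → BelowIterate x → ∃ λ n → x ≪ iter L f n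
      below-iterate = toWitness {a? = em}

      below-iterate⁻¹ : ∀ {x} → (∃ λ n → x ≪ iter L f n) → BelowIterate x
      below-iterate⁻¹ = fromWitness {a? = em}

      below-iterates-directed : Directed L BelowIterate
      below-iterates-directed =
        (bot L , below-iterate⁻¹ (0 , bot-≪)) ,
        λ x∈ y∈ → upper-bound (below-iterate x∈) (below-iterate y∈)
        where
        upper-bound : ∀ {x y} → (∃ λ m → x ≪ iter L f m) → (∃ λ n → y ≪ iter L f n) →
                      ∃ λ z → BelowIterate z × x ⊑ z × y ⊑ z
        upper-bound {x} {y} (m , x≪fᵐ) (n , y≪fⁿ) =
          ⨆ L (x ∷ y ∷ []) ,
          below-iterate⁻¹ (m ⊔ n , ≪-pair (≪-⊑-trans x≪fᵐ (iter-mono (m≤m⊔n m n)))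
                                          (≪-⊑-trans y≪fⁿ (iter-mono (m≤n⊔m m n)))) ,
          ⋁-upper _ (here refl) , ⋁-upper _ (there (here refl))

      lfp⊑⋁below-iterates : μ ⊑ ⋁ BelowIterate
      lfp⊑⋁below-iterates = ⊑-trans lfp⊑⋁iterates (⋁-least _ λ
        { (n , refl) → proj₂ (L-continuous (iter L f n)) _ λ l l≪fⁿ → ⋁-upper _ (below-iterate⁻¹ (n , l≪fⁿ)) })

      ≪-lfp⇒≪-iter : ∀ {x} → x ≪ μ → ∃ λ n → x ≪ iter L f n
      ≪-lfp⇒≪-iter x≪μ with x≪μ BelowIterate below-iterates-directed lfp⊑⋁below-iterates
      ... | d , d∈ , x⊑d with below-iterate d∈
      ...   | n , d≪fⁿ = n , ⊑-≪-trans x⊑d d≪fⁿ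

      ≪-lfp⇒Deg : ∀ {x} → x ≪ μ → ∃ (Deg L f x)
      ≪-lfp⇒Deg x≪μ with ≪-lfp⇒≪-iter x≪μ
      ... | n , x≪fⁿ with ≪-iter⇒Deg≤ em {n = n} x≪fⁿ
      ...   | i , _ , x-deg = i , x-deg

FinitaryWinningStrategy : (B : CompleteLattice) → (Carrier B → Set) → (Carrier B → Carrier B) →
                          Carrier B → (Carrier B → List (Carrier B)) → Set₁
FinitaryWinningStrategy B JB β μβ S = ∀ b → JB b → [ B ] b ≪ μβ →
  All JB (S b) × ([ B ] b ≪ β (⨆ B (S b))) ×
  (∀ b' → b' ∈ S b → ∀ n → Deg B β b n → ∃ λ m → (m < n) × Deg B β b' m)

WitnessChoice : (L B : CompleteLattice) → (Carrier L → Set) → (Carrier B → Set) →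
                (Carrier L → Carrier B) → (Carrier L → Carrier L) →
                (Carrier B → List (Carrier L) → Carrier L) → Set₁
WitnessChoice L B JL JB α lam P = ∀ b A → JB b → All JL A → [ B ] b ≪ α (lam (⨆ L A)) →
  JL (P b A) × ([ L ] P b A ≪ lam (⨆ L A)) × ([ B ] b ≪ α (P b A))

module Construction
    (em : ExcludedMiddle (lsuc 0ℓ))
    (L B : CompleteLattice) (JL : Carrier L → Set) (JB : Carrier B → Set) (bot∉JB : ¬ JB (bot B))
    (α : Carrier L → Carrier B) (α-mono : Monotone L B α)
    (lam : Carrier L → Carrier L) (β : Carrier B → Carrier B)
    (lam-mono : Monotone L L lam) (β-mono : Monotone B B β)
    (α∘lam≡β∘α : ∀ x → α (lam x) ≡ β (α x))
    {μλ : Carrier L} (μλ-fixed : lam μλ ≡ μλ)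
    {μβ : Carrier B} (μβ-fixed : β μβ ≡ μβ)
    (finite-degree : ∀ {b} → [ B ] b ≪ μβ → ∃ (Deg B β b))
    (S : Carrier B → List (Carrier B)) (S-wins : FinitaryWinningStrategy B JB β μβ S)
    (P : Carrier B → List (Carrier L) → Carrier L) (P-chooses : WitnessChoice L B JL JB α lam P)
  where
  private
    module L = WayBelow L
    module B = WayBelow B
    module Kλ = Kleene L lam lam-mono
    module Kβ = Kleene B β β-mono

  Deg⇒≪μβ : ∀ {b n} → Deg B β b n → [ B ] b ≪ μβ
  Deg⇒≪μβ {n = n} (b≪βⁿ , _) = B.≪-⊑-trans b≪βⁿ (Kβ.iter⊑fixpoint μβ-fixed n)

  basic⇒¬Deg0 : ∀ {b} → JB b → ¬ Deg B β b 0
  basic⇒¬Deg0 b∈J (b≪bot , _) = bot∉JB (subst JB (B.≪bot⇒≡bot b≪bot) b∈J)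

  record BasicOfDegree≤ (n : ℕ) (x : Carrier B) : Set₁ where
    field
      basic   : JB x
      deg     : ℕ
      deg≤    : deg ≤ n
      has-deg : Deg B β x deg

  child : ∀ {n b x} → JB b → Deg B β b (suc n) → x ∈ S b → BasicOfDegree≤ n x
  child b∈J b-deg x∈S with S-wins _ b∈J (Deg⇒≪μβ b-deg)
  ... | S-basic , _ , S-decreases with S-decreases _ x∈S _ b-deg
  ...   | m , m<1+n , x-deg = record
    { basic = lookup S-basic x∈S ; deg = m ; deg≤ = ≤-pred m<1+n ; has-deg = x-deg }

  degree-induction : ∀ {ℓ} (Q : ℕ → Carrier B → Set ℓ) →
    (∀ {n b} → (∀ {m x} → m ≤ n → JB x → Deg B β x m → Q m x) → JB b → Deg B β b (suc n) → Q (suc n) b) →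
    ∀ {n b} → JB b → Deg B β b n → Q n b
  degree-induction Q step = <-rec (λ n → ∀ {b} → JB b → Deg B β b n → Q n b) induct _
    where
    induct : ∀ n → (∀ {m} → m < n → ∀ {b} → JB b → Deg B β b m → Q m b) →
             ∀ {b} → JB b → Deg B β b n → Q n b
    induct zero    _  b∈J b-deg = ⊥-elim (basic⇒¬Deg0 b∈J b-deg)
    induct (suc n) IH b∈J b-deg = step (λ m≤n → IH (s≤s m≤n)) b∈J b-deg

  -- The value at 0 is junk: no element of J_B has degree 0.
  approx : ℕ → Carrier B → Carrier L
  approx zero    b = P b []
  approx (suc n) b = P b (map (approx n) (S b))

  P-map-cong : ∀ {b f g} → (∀ {x} → x ∈ S b → f x ≡ g x) → P b (map f (S b)) ≡ P b (map g (S b))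
  P-map-cong f≗g = cong (P _) (map-cong-local (tabulate f≗g))

  Stable : ℕ → Carrier B → Set
  Stable n b = ∀ {k} → n ≤ k → approx k b ≡ approx n b

  approx-stable : ∀ {n b} → JB b → Deg B β b n → Stable n b
  approx-stable = degree-induction Stable stable
    where
    stable : ∀ {n b} → (∀ {m x} → m ≤ n → JB x → Deg B β x m → Stable m x) →
             JB b → Deg B β b (suc n) → Stable (suc n) b
    stable {n} IH b∈J b-deg {suc k} (s≤s n≤k) = P-map-cong λ x∈S →
      let open BasicOfDegree≤ (child b∈J b-deg x∈S)
      in trans (IH deg≤ basic has-deg (≤-trans deg≤ n≤k)) (sym (IH deg≤ basic has-deg deg≤))

  P-map≡approx : ∀ {n b} (f : Carrier B → Carrier L) →
    (∀ {m x} → m ≤ n → JB x → Deg B β x m → f x ≡ approx m x) →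
    JB b → Deg B β b (suc n) → P b (map f (S b)) ≡ approx (suc n) b
  P-map≡approx f f≡approx b∈J b-deg = P-map-cong λ x∈S →
    let open BasicOfDegree≤ (child b∈J b-deg x∈S)
    in trans (f≡approx deg≤ basic has-deg) (sym (approx-stable basic has-deg deg≤))

  Sound : ℕ → Carrier B → Set₁
  Sound n b = JL (approx n b) × ([ B ] b ≪ α (approx n b)) × ([ L ] approx n b ≪ iter L lam n)

  sound-mono : ∀ {m n x} → m ≤ n → JB x → Deg B β x m → Sound m x → Sound n x
  sound-mono m≤n x∈J x-deg (a∈J , x≪αa , a≪λᵐ) rewrite approx-stable x∈J x-deg m≤n =
    a∈J , x≪αa , L.≪-⊑-trans a≪λᵐ (Kλ.iter-mono m≤n)

  sound-step : ∀ {n b} → JB b → [ B ] b ≪ μβ → (∀ {x} → x ∈ S b → Sound n x) → Sound (suc n) b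
  sound-step {n} {b} b∈J b≪μβ children = chosen (P-chooses b A b∈J A-basic b≪αλ⨆A)
    where
    A : List (Carrier L)
    A = map (approx n) (S b)

    A-basic : All JL A
    A-basic = map⁺ (tabulate λ x∈S → proj₁ (children x∈S))

    ⨆S⊑α⨆A : ⨆ B (S b) B.⊑ α (⨆ L A)
    ⨆S⊑α⨆A = B.⋁-least _ λ x∈S →
      B.⊑-trans (B.≪⇒⊑ (proj₁ (proj₂ (children x∈S)))) (α-mono (L.⋁-upper _ (∈-map⁺ (approx n) x∈S)))

    b≪αλ⨆A : [ B ] b ≪ α (lam (⨆ L A))
    b≪αλ⨆A = B.≪-⊑-trans (proj₁ (proj₂ (S-wins b b∈J b≪μβ)))
                          (B.⊑-trans (β-mono ⨆S⊑α⨆A) (B.⊑-reflexive (sym (α∘lam≡β∘α _))))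

    ⨆A⊑λⁿ : ⨆ L A L.⊑ iter L lam n
    ⨆A⊑λⁿ = L.⋁-least _ λ a∈A → below (∈-map⁻ (approx n) a∈A)
      where
      below : ∀ {a} → ∃ (λ x → x ∈ S b × a ≡ approx n x) → a L.⊑ iter L lam n
      below (_ , x∈S , refl) = L.≪⇒⊑ (proj₂ (proj₂ (children x∈S)))

    chosen : JL (P b A) × ([ L ] P b A ≪ lam (⨆ L A)) × ([ B ] b ≪ α (P b A)) → Sound (suc n) b
    chosen (a∈J , a≪λ⨆A , b≪αa) = a∈J , b≪αa , L.≪-⊑-trans a≪λ⨆A (lam-mono ⨆A⊑λⁿ)

  approx-sound : ∀ {n b} → JB b → Deg B β b n → Sound n b
  approx-sound = degree-induction Sound λ {n} IH b∈J b-deg → sound-step {n} b∈J (Deg⇒≪μβ b-deg) λ x∈S →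
    let open BasicOfDegree≤ (child b∈J b-deg x∈S)
    in sound-mono deg≤ basic has-deg (IH deg≤ basic has-deg)

  wit : Carrier B → Carrier L
  wit b with em {∃ (Deg B β b)}
  ... | yes (n , _) = approx n b
  ... | no _        = approx 0 b

  wit≡approx : ∀ {b n} → Deg B β b n → wit b ≡ approx n b
  wit≡approx {b} {n} b-deg with em {∃ (Deg B β b)}
  ... | yes (m , b-deg′) = cong (λ k → approx k b) (Kβ.Deg-unique b-deg′ b-deg)
  ... | no no-deg        = ⊥-elim (no-deg (n , b-deg))

  IsSolution : (Carrier B → Carrier L) → Set₁
  IsSolution w = ∀ b → JB b → [ B ] b ≪ μβ → w b ≡ P b (map w (S b))

  wit-solution : IsSolution wit
  wit-solution b b∈J b≪μβ with finite-degree b≪μβ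
  ... | zero  , b-deg = ⊥-elim (basic⇒¬Deg0 b∈J b-deg)
  ... | suc n , b-deg = trans (wit≡approx b-deg) (sym (P-map≡approx wit (λ _ _ → wit≡approx) b∈J b-deg))

  solution≡approx : ∀ {w} → IsSolution w → ∀ {n b} → JB b → Deg B β b n → w b ≡ approx n b
  solution≡approx {w} w-solution = degree-induction (λ n b → w b ≡ approx n b) λ IH b∈J b-deg →
    trans (w-solution _ b∈J (Deg⇒≪μβ b-deg)) (P-map≡approx w IH b∈J b-deg)

  solution-unique : ∀ w → IsSolution w → ∀ b → JB b → [ B ] b ≪ μβ → w b ≡ wit b
  solution-unique w w-solution b b∈J b≪μβ with finite-degree b≪μβ
  ... | _ , b-deg = trans (solution≡approx w-solution b∈J b-deg) (sym (wit≡approx b-deg))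

  wit-primal : ∀ b → JB b → [ B ] b ≪ μβ → PrimalWitness L B α μλ b (wit b)
  wit-primal b b∈J b≪μβ with finite-degree b≪μβ
  ... | n , b-deg rewrite wit≡approx b-deg with approx-sound b∈J b-deg
  ...   | _ , b≪αa , a≪λⁿ = L.≪-⊑-trans a≪λⁿ (Kλ.iter⊑fixpoint μλ-fixed n) , b≪αa

  wit-degree≤ : ∀ b → JB b → ∀ n → Deg B β b n → ∃ λ i → i ≤ n × Deg L lam (wit b) i
  wit-degree≤ b b∈J n b-deg rewrite wit≡approx b-deg =
    Kλ.≪-iter⇒Deg≤ em (proj₂ (proj₂ (approx-sound b∈J b-deg)))

theorem18 :
    ExcludedMiddle (lsuc 0ℓ) →
    (L B : CompleteLattice) →
    IsContinuous L → IsContinuous B →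
    (JL : Carrier L → Set) (JB : Carrier B → Set) →
    IsJoinBasis L JL → IsJoinBasis B JB →
    ¬ JL (bot L) → ¬ JB (bot B) →
    (∀ b → JB b → WayBelowIrreducible B b) →
    (α : Carrier L → Carrier B) (γ : Carrier B → Carrier L) →
    GaloisConnection L B α γ →
    (lam : Carrier L → Carrier L) (β : Carrier B → Carrier B) →
    Monotone L L lam → Monotone B B β →
    (∀ x → α (lam x) ≡ β (α x)) →
    ScottContinuous B β →
    (μλ : Carrier L) → IsLfp L lam μλ →
    (μβ : Carrier B) → IsLfp B β μβ →
    (S : Carrier B → List (Carrier B)) →
    (∀ b → JB b → [ B ] b ≪ μβ →
      All JB (S b) × ([ B ] b ≪ β (⨆ B (S b))) ×
      (∀ b' → b' ∈ S b → ∀ n → Deg B β b n → ∃ λ m → (m < n) × Deg B β b' m)) →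
    (P : Carrier B → List (Carrier L) → Carrier L) →
    (∀ b A → JB b → All JL A → [ B ] b ≪ α (lam (⨆ L A)) →
      JL (P b A) × ([ L ] P b A ≪ lam (⨆ L A)) × ([ B ] b ≪ α (P b A))) →
    Σ (Carrier B → Carrier L) λ wit →
      (∀ b → JB b → [ B ] b ≪ μβ → wit b ≡ P b (map wit (S b))) ×
      (∀ (wit' : Carrier B → Carrier L) →
        (∀ b → JB b → [ B ] b ≪ μβ → wit' b ≡ P b (map wit' (S b))) →
        ∀ b → JB b → [ B ] b ≪ μβ → wit' b ≡ wit b) ×
      (∀ b → JB b → [ B ] b ≪ μβ →
        PrimalWitness L B α μλ b (wit b) ×
        (∀ n → Deg B β b n → ∃ λ i → (i ≤ n) × Deg L lam (wit b) i))
theorem18 em L B _ B-continuous JL JB _ _ _ bot∉JB _ α _ (α-mono , _) lam β lam-mono β-mono α∘lam≡β∘α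
          β-continuous μλ (μλ-fixed , _) μβ μβ-lfp S S-wins P P-chooses =
  wit , wit-solution , solution-unique , λ b b∈J b≪μβ → wit-primal b b∈J b≪μβ , wit-degree≤ b b∈J
  where
  open Construction em L B JL JB bot∉JB α α-mono lam β lam-mono β-mono α∘lam≡β∘α μλ-fixed (proj₁ μβ-lfp)
    (Kleene.≪-lfp⇒Deg B β β-mono β-continuous μβ-lfp em B-continuous) S S-wins P P-chooses
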